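{- For every LTL$_+$ formula $\phi$ and every finite word $\sigma\in(2^{AP})^*$, \[ \sigma\,\emptyset^{\omega}\models\phi \iff \forall\rho\in(2^{AP})^{\omega}:\ \sigma\rho\models\phi . \]
   Context: LTL$_+$ formulas over a set $AP$ of atomic propositions are given by the grammar $\phi::=\mathrm{true}\mid\mathrm{false}\mid a\mid\phi\wedge\phi\mid\phi\vee\phi\mid\bigcirc\phi\mid\phi_1\mathbin{\mathcal{U}}\phi_2\mid\phi_1\mathbin{\mathcal{R}}\phi_2$ with $a\in AP$ (no negation), interpreted over infinite words in $(2^{AP})^\omega$ with the standard LTL semantics ($\mathcal{R}$ is the release operator, dual of until). $\emptyset^\omega$ is the infinite word all of whose letters are the empty set. -}

module Defs where

open import Data.Bool using (Bool; true; false; T)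
open import Data.Nat using (ℕ; zero; suc; _+_; _≤_; _<_)
open import Data.List using (List; []; _∷_)
open import Data.Product using (_×_; Σ; ∃-syntax)
open import Data.Sum using (_⊎_)
open import Data.Unit using (⊤)
open import Data.Empty using (⊥)

data LTL+ (AP : Set) : Set where
  tt ff   : LTL+ AP
  atom    : AP → LTL+ AP
  _∧'_ _∨'_ : LTL+ AP → LTL+ AP → LTL+ AP
  ○_      : LTL+ AP → LTL+ AP
  _U_ _R_ : LTL+ AP → LTL+ AP → LTL+ AP

-- a letter of 2^AP, represented by its characteristic function
Letter : Set → Set
Letter AP = AP → Bool

∅ : {AP : Set} → Letter AP
∅ _ = false

Word : Set → Set
Word AP = ℕ → Letter AP

FinWord : Set → Set
FinWord AP = List (Letter AP)

suffix : {AP : Set} → Word AP → ℕ → Word AP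
suffix w i n = w (i + n)

_·_ : {AP : Set} → FinWord AP → Word AP → Word AP
([] · ρ) n = ρ n
((a ∷ σ) · ρ) zero = a
((a ∷ σ) · ρ) (suc n) = (σ · ρ) n

∅ω : {AP : Set} → Word AP
∅ω _ = ∅

infix 4 _⊨_
_⊨_ : {AP : Set} → Word AP → LTL+ AP → Set
w ⊨ tt = ⊤
w ⊨ ff = ⊥
w ⊨ atom a = T (w 0 a)
w ⊨ (φ ∧' ψ) = (w ⊨ φ) × (w ⊨ ψ)
w ⊨ (φ ∨' ψ) = (w ⊨ φ) ⊎ (w ⊨ ψ)
w ⊨ (○ φ) = suffix w 1 ⊨ φ
w ⊨ (φ U ψ) = ∃[ j ] ((suffix w j ⊨ ψ) × (∀ i → i < j → suffix w i ⊨ φ))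
w ⊨ (φ R ψ) = ∀ j → (suffix w j ⊨ ψ) ⊎ (∃[ i ] ((i < j) × (suffix w i ⊨ φ)))

module Submission where

-- Negation-free formulas are monotone in the letters of the word: enlarging
-- letters pointwise preserves satisfaction. Since ∅ is the least letter,
-- σ∅^ω is pointwise below every σρ, and conversely ∅^ω is one choice of ρ.

open import Defs
open import Data.Bool using (T)
open import Data.Nat using (ℕ; zero; suc; _+_)
open import Data.List using ([]; _∷_)
open import Data.Product using (_×_; _,_)
open import Data.Sum using (inj₁; inj₂)

infix 4 _⊑_
_⊑_ : {AP : Set} → Word AP → Word AP → Set
_⊑_ {AP} w w′ = (n : ℕ) (a : AP) → T (w n a) → T (w′ n a)

suffix-mono : {AP : Set} {w w′ : Word AP} → w ⊑ w′ → ∀ i → suffix w i ⊑ suffix w′ i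
suffix-mono w⊑w′ i n = w⊑w′ (i + n)

⊨-mono : {AP : Set} (φ : LTL+ AP) {w w′ : Word AP} → w ⊑ w′ → w ⊨ φ → w′ ⊨ φ
⊨-mono tt       w⊑w′ _ = _
⊨-mono ff       w⊑w′ ()
⊨-mono (atom a) w⊑w′ p = w⊑w′ 0 a p
⊨-mono (φ ∧' ψ) w⊑w′ (p , q) = ⊨-mono φ w⊑w′ p , ⊨-mono ψ w⊑w′ q
⊨-mono (φ ∨' ψ) w⊑w′ (inj₁ p) = inj₁ (⊨-mono φ w⊑w′ p)
⊨-mono (φ ∨' ψ) w⊑w′ (inj₂ q) = inj₂ (⊨-mono ψ w⊑w′ q)
⊨-mono (○ φ)    w⊑w′ p = ⊨-mono φ (suffix-mono w⊑w′ 1) p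
⊨-mono (φ U ψ)  w⊑w′ (j , q , p) =
  j , ⊨-mono ψ (suffix-mono w⊑w′ j) q ,
  λ i i<j → ⊨-mono φ (suffix-mono w⊑w′ i) (p i i<j)
⊨-mono (φ R ψ)  w⊑w′ h j with h j
... | inj₁ q             = inj₁ (⊨-mono ψ (suffix-mono w⊑w′ j) q)
... | inj₂ (i , i<j , p) = inj₂ (i , i<j , ⊨-mono φ (suffix-mono w⊑w′ i) p)

·∅ω-⊑ : {AP : Set} (σ : FinWord AP) (ρ : Word AP) → σ · ∅ω ⊑ σ · ρ
·∅ω-⊑ []      ρ n       a ()
·∅ω-⊑ (x ∷ σ) ρ zero    a p = p
·∅ω-⊑ (x ∷ σ) ρ (suc n) a p = ·∅ω-⊑ σ ρ n a p

proposition6 : {AP : Set} (φ : LTL+ AP) (σ : FinWord AP) →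
    ((σ · ∅ω) ⊨ φ → ((ρ : Word AP) → (σ · ρ) ⊨ φ)) ×
    (((ρ : Word AP) → (σ · ρ) ⊨ φ) → (σ · ∅ω) ⊨ φ)
proposition6 φ σ = (λ h ρ → ⊨-mono φ (·∅ω-⊑ σ ρ) h) , (λ h → h ∅ω)
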